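{- Let $n$ and $k$ be nonnegative integers with $n\ge 2k$. For every graph $G\in\mathcal{M}_{n,k}$ we have $b^A_g(G)=b^I_g(G)=k$.
   Context: The balance game on a finite simple graph $G$ is played by two players, Admirable (A) and Impish (I), who alternately select a not-yet-labeled vertex of $G$ until all vertices are labeled; Admirable labels each vertex she selects by $0$ and Impish labels each vertex he selects by $1$. Each edge receives the sum modulo $2$ of the labels of its endpoints. Let $e_0$ and $e_1$ be the numbers of edges labeled $0$ and $1$ at the end; the discrepancy is $d=e_1-e_0$. Admirable tries to minimize $d$ and Impish tries to maximize $d$. $b^A_g(G)$ is the value of $d$ under optimal play when Admirable moves first, and $b^I_g(G)$ is the value under optimal play when Impish moves first. The class $\mathcal{M}_{n,k}$ consists of the graphs on $n$ vertices obtained as follows. Take $\lfloor n/2\rfloor$ disjoint vertex pairs $f_1,\dots,f_{\lfloor n/2\rfloor}$, where each of $f_1,\dots,f_k$ induces a copy of $K_2$ (the two vertices are adjacent) and each of $f_{k+1},\dots,f_{\lfloor n/2\rfloor}$ induces $\overline{K_2}$ (the two vertices are nonadjacent); if $n$ is odd, add one further vertex $v$. Between any two pairs $f_i,f_j$ ($i\ne j$) insert either no edges, or a $P_3$ (i.e., one vertex of one pair is joined to both vertices of the other pair, and no other edges between them), or a $K_{2,2}$ (all four edges between the two pairs). Between $v$ and any pair $f_i$ insert either no edges or a $P_3$ (i.e., $v$ is joined to both vertices of $f_i$). No other edges are present. -}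

module Defs where

open import Data.Bool using (Bool; true; false; if_then_else_; _∧_; _xor_)
open import Data.Nat using (ℕ; zero; suc; _*_; _≤_; _<ᵇ_; _≡ᵇ_; _/_; _%_)
open import Data.Fin using (Fin; toℕ; _≟_)
open import Data.Fin.Permutation using (Permutation′; _⟨$⟩ʳ_)
open import Data.Integer using (ℤ; +_; -_; _+_; _⊓_; _⊔_)
open import Data.List using (List; []; _∷_; foldr; map; allFin)
open import Data.Maybe using (Maybe; just; nothing)
open import Data.Product using (Σ; ∃; _×_)
open import Relation.Binary.PropositionalEquality using (_≡_)
open import Relation.Nullary using (yes; no)

record SimpleGraph (n : ℕ) : Set where
  field
    adj    : Fin n → Fin n → Bool
    sym    : ∀ x y → adj x y ≡ adj y x
    irrefl : ∀ x → adj x x ≡ false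
open SimpleGraph public

-- The balance game.
-- Labels: false = 0 (Admirable), true = 1 (Impish).

data Player : Set where
  Adm Imp : Player

other : Player → Player
other Adm = Imp
other Imp = Adm

labelOf : Player → Bool
labelOf Adm = false
labelOf Imp = true

-- partial labelling (nothing = not yet labelled)
State : ℕ → Set
State n = Fin n → Maybe Bool

emptyState : ∀ {n} → State n
emptyState _ = nothing

update : ∀ {n} → State n → Fin n → Bool → State n
update s v b u with u ≟ v
... | yes _ = just b
... | no  _ = s u

unlabeled : ∀ {n} → State n → List (Fin n)
unlabeled {n} s = foldr step [] (allFin n)
  where
  step : Fin n → List (Fin n) → List (Fin n)
  step v acc with s v
  ... | nothing = v ∷ acc
  ... | just _  = acc

-- final label of a vertex (only used when every vertex is labelled)
finalLabel : ∀ {n} → State n → Fin n → Bool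
finalLabel s v with s v
... | just b  = b
... | nothing = false

sumPairs : ∀ {n} → (Fin n → Fin n → ℤ) → ℤ
sumPairs {n} f = foldr (λ x acc → foldr (λ y acc′ → f x y + acc′) acc (allFin n)) (+ 0) (allFin n)

-- discrepancy d = e₁ − e₀: each edge {x,y} (counted once, via toℕ x < toℕ y)
-- contributes +1 if its label x+y mod 2 is 1 and −1 if it is 0
discrepancy : ∀ {n} → SimpleGraph n → (Fin n → Bool) → ℤ
discrepancy G ℓ = sumPairs λ x y →
  if (toℕ x <ᵇ toℕ y) ∧ adj G x y
  then (if ℓ x xor ℓ y then + 1 else - (+ 1))
  else + 0

optimum : Player → ℤ → List ℤ → ℤ
optimum Adm z zs = foldr _⊓_ z zs
optimum Imp z zs = foldr _⊔_ z zs

gameValue : ∀ {n} → SimpleGraph n → ℕ → Player → State n → ℤ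
gameValue G zero    p s = discrepancy G (finalLabel s)
gameValue G (suc m) p s with unlabeled s
... | []     = discrepancy G (finalLabel s)
... | v ∷ vs = optimum p (next v) (map next vs)
  where
  next : _ → ℤ
  next u = gameValue G m (other p) (update s u (labelOf p))

bgA : ∀ {n} → SimpleGraph n → ℤ
bgA {n} G = gameValue G n Adm emptyState

bgI : ∀ {n} → SimpleGraph n → ℤ
bgI {n} G = gameValue G n Imp emptyState

-- The class M_{n,k}.
-- Canonical layout on vertices 0..n-1 (as naturals): pair f_i = {2i, 2i+1}
-- for i < ⌊n/2⌋, and (n odd) the extra vertex v = 2⌊n/2⌋ = n-1.

-- connection between pairs f_i, f_j with i < j
data Conn : Set where
  noEdges : Conn
  k22     : Conn
  p3low   : Fin 2 → Conn  -- vertex 2i+s of f_i joined to both vertices of f_j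
  p3high  : Fin 2 → Conn  -- vertex 2j+s of f_j joined to both vertices of f_i

-- edge between side sx of the lower pair and side sy of the higher pair
connEdge : Conn → ℕ → ℕ → Bool
connEdge noEdges    sx sy = false
connEdge k22        sx sy = true
connEdge (p3low s)  sx sy = sx ≡ᵇ toℕ s
connEdge (p3high s) sx sy = sy ≡ᵇ toℕ s

-- adjacency of the canonical graph with parameters
--   c i j   (used for i < j) : connection between f_i and f_j
--   cv i                    : whether v is joined (by a P₃) to f_i
canonAdj : (n k : ℕ) → (ℕ → ℕ → Conn) → (ℕ → Bool) → ℕ → ℕ → Bool
canonAdj n k c cv x y =
  if x ≡ᵇ y then false
  else if inPair x ∧ inPair y then pairEdge
  else if inPair x then cv (x / 2)
  else if inPair y then cv (y / 2)
  else false
  where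
  inPair : ℕ → Bool
  inPair z = z <ᵇ 2 * (n / 2)
  pairEdge : Bool
  pairEdge =
    if x / 2 ≡ᵇ y / 2 then x / 2 <ᵇ k   -- f_i induces K₂ iff i < k
    else if x / 2 <ᵇ y / 2 then connEdge (c (x / 2) (y / 2)) (x % 2) (y % 2)
    else connEdge (c (y / 2) (x / 2)) (y % 2) (x % 2)

-- G ∈ M_{n,k}: G is isomorphic (via a relabelling π of its vertices)
-- to a canonical graph built from some choice of connections
InM : (n k : ℕ) → SimpleGraph n → Set
InM n k G =
  Σ (ℕ → ℕ → Conn) λ c → Σ (ℕ → Bool) λ cv → Σ (Permutation′ n) λ π →
    ∀ (x y : Fin n) → adj G (π ⟨$⟩ʳ x) (π ⟨$⟩ʳ y) ≡ canonAdj n k c cv (toℕ x) (toℕ y)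

{-# OPTIONS --safe #-}
-- If the final labelling
-- gives the two vertices of each pair different labels, the discrepancy is exactly k: each K₂ pair
-- is an edge labelled 1, and every other edge lies in a P₃ joining a vertex to both vertices of a
-- pair (a K₂,₂ is two of them), which has one edge labelled 0 and one labelled 1. Either player
-- forces such a labelling by the pairing strategy: answer a move on a vertex whose partner is free
-- by labelling the partner; otherwise take v if it is free, and else any vertex, whose partner the
-- opponent must eventually label. So each player guarantees discrepancy k whoever starts.
module Submission where

open import Defs renaming (sym to adj-sym)
open import Data.Bool using (Bool; true; false; not; _xor_; _∧_; if_then_else_; T)
import Data.Bool.Properties as Boolₚ
open import Data.Empty using (⊥-elim)
open import Data.Fin using (Fin; zero; suc; toℕ; fromℕ<) renaming (_≟_ to _≟ᶠ_)
open import Data.Fin.Permutation using (Permutation′; _⟨$⟩ʳ_; _⟨$⟩ˡ_; inverseˡ; inverseʳ)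
open import Data.Fin.Properties as Finₚ using (any?)
open import Data.Integer as ℤ using (ℤ; +_; -_; _+_)
import Data.Integer.Properties as ℤₚ
open import Algebra.Properties.CommutativeMonoid.Sum ℤₚ.+-0-commutativeMonoid
  using (sum; sum-syntax; sum-cong-≗; ∑-distrib-+; ∑-comm; sum-permute; sum-init-last; sum-replicate-zero)
open import Algebra.Properties.CommutativeSemigroup ℤₚ.+-commutativeSemigroup using (interchange)
open import Data.List using (List; []; _∷_; foldr; filter; allFin; map; length; tabulate)
open import Data.List.Membership.Propositional using (_∈_; lose)
open import Data.List.Membership.Propositional.Properties using (∈-allFin; ∈-filter⁺; ∈-filter⁻)
open import Data.List.Properties using (filter-reject; filter-notAll; filter-none; length-filter; length-tabulate;
  foldr-cong; foldr-preservesᵇ; foldr-preservesᵒ)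
open import Data.List.Relation.Unary.All as All using (All)
import Data.List.Relation.Unary.All.Properties as All
open import Data.List.Relation.Unary.Any as Any using (Any; here; there)
import Data.List.Relation.Unary.Any.Properties as Any
open import Data.Maybe as Maybe using (just; nothing)
import Data.Maybe.Properties as Maybeₚ
open import Data.Nat as ℕ using (ℕ; zero; suc; _*_; _≤_; _<_; z≤n; s≤s; z<s; _<ᵇ_; _≡ᵇ_; _/_; _%_)
import Data.Nat.Properties as ℕₚ
open import Data.Nat.DivMod
  using (/-monoˡ-≤; +-distrib-/-∣ʳ; m<n⇒m/n≡0; m*n/n≡m; [m+kn]%n≡m%n; m<n⇒m%n≡m; m%n<n; m≡m%n+[m/n]*n)
open import Data.Nat.Divisibility using (divides)
open import Data.Product using (Σ; _×_; _,_; proj₁; proj₂)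
open import Data.Sum using (_⊎_; inj₁; inj₂; [_,_]; swap)
open import Data.Unit using (tt)
open import Function using (_∘_; _$_; case_of_)
open import Level using (0ℓ)
open import Relation.Binary using (tri<; tri≈; tri>)
open import Relation.Binary.PropositionalEquality
  using (_≡_; _≢_; _≗_; refl; sym; trans; cong; cong₂; subst; module ≡-Reasoning)
open import Relation.Nullary using (¬_; Dec; yes; no; _×-dec_)
open import Relation.Unary using (Pred; Decidable)

private variable
  n m N i j k : ℕ
  s t : State n
  u v w x : Fin n
  a b : Bool
  f g : ℕ → ℤ

Unlabeled : State n → Fin n → Set
Unlabeled s x = s x ≡ nothing

Complete : State n → Set
Complete s = ∀ x → ¬ Unlabeled s x

unlabeled? : (s : State n) → Decidable (Unlabeled s)
unlabeled? s x = Maybeₚ.≡-dec Boolₚ._≟_ (s x) nothing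

unlabeled≡filter : (s : State n) → unlabeled s ≡ filter (unlabeled? s) (allFin n)
unlabeled≡filter {n} s = trans (proj₂ as-fold) (fold≡filter (allFin n))
  where
  -- The step function of `unlabeled` is local to its where clause; unifying with refl names it.
  as-fold : Σ (Fin n → List (Fin n) → List (Fin n)) λ step → unlabeled s ≡ foldr step [] (allFin n)
  as-fold = _ , refl
  fold≡filter : ∀ xs → foldr (proj₁ as-fold) [] xs ≡ filter (unlabeled? s) xs
  fold≡filter []       = refl
  fold≡filter (x ∷ xs) with s x
  ... | nothing = cong (x ∷_) (fold≡filter xs)
  ... | just _  = fold≡filter xs

∈-unlabeled⁺ : Unlabeled s x → x ∈ unlabeled s
∈-unlabeled⁺ {n} {s} {x} ux =
  subst (x ∈_) (sym (unlabeled≡filter s)) (∈-filter⁺ (unlabeled? s) (∈-allFin x) ux)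

∈-unlabeled⁻ : x ∈ unlabeled s → Unlabeled s x
∈-unlabeled⁻ {n} {x} {s} x∈ =
  proj₂ (∈-filter⁻ (unlabeled? s) {xs = allFin n} (subst (x ∈_) (unlabeled≡filter s) x∈))

unlabeled-complete : Complete s → unlabeled s ≡ []
unlabeled-complete {n} {s} complete =
  trans (unlabeled≡filter s) (filter-none (unlabeled? s) {xs = allFin n} (All.tabulate λ {x} _ → complete x))

module _ {A : Set} {P Q : Pred A 0ℓ} (P? : Decidable P) (Q? : Decidable Q) where

  filter-filter-⊆ : (∀ {x} → P x → Q x) → ∀ xs → filter P? (filter Q? xs) ≡ filter P? xs
  filter-filter-⊆ P⇒Q [] = refl
  filter-filter-⊆ P⇒Q (x ∷ xs) with Q? x
  ... | no ¬q = trans (filter-filter-⊆ P⇒Q xs) (sym (filter-reject P? (¬q ∘ P⇒Q)))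
  ... | yes _ with P? x
  ...   | yes _ = cong (x ∷_) (filter-filter-⊆ P⇒Q xs)
  ...   | no _ = filter-filter-⊆ P⇒Q xs

update-same : (s : State n) (w : Fin n) (b : Bool) → update s w b w ≡ just b
update-same s w b with w ≟ᶠ w
... | yes _ = refl
... | no w≢w = ⊥-elim (w≢w refl)

update-other : (s : State n) {w x : Fin n} (b : Bool) → x ≢ w → update s w b x ≡ s x
update-other s {w} {x} b x≢w with x ≟ᶠ w
... | yes x≡w = ⊥-elim (x≢w x≡w)
... | no _ = refl

update-unlabeled : (s : State n) (w : Fin n) (b : Bool) → Unlabeled (update s w b) x → Unlabeled s x
update-unlabeled {x = x} s w b ux with x ≟ᶠ w
... | no _ = ux

update-cong : s ≗ t → (w : Fin n) (b : Bool) → update s w b ≗ update t w b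
update-cong s≗t w b x with x ≟ᶠ w
... | yes _ = refl
... | no _ = s≗t x

update-comm : (s : State n) → v ≢ w → update (update s v a) w b ≗ update (update s w b) v a
update-comm {n} {v} {w} {a} {b} s v≢w x = by-cases (x ≟ᶠ v) (x ≟ᶠ w)
  where
  sv sw : State n
  sv = update s v a
  sw = update s w b
  by-cases : Dec (x ≡ v) → Dec (x ≡ w) → update sv w b x ≡ update sw v a x
  by-cases (yes refl) _ = trans (update-other sv b v≢w) (trans (update-same s v a) (sym (update-same sw v a)))
  by-cases (no x≢v) (yes refl) = trans (update-same sv w b) (sym (trans (update-other sw a x≢v) (update-same s w b)))
  by-cases (no x≢v) (no x≢w) = trans (update-other sv b x≢w)
    (trans (update-other s a x≢v) (sym (trans (update-other sw a x≢v) (update-other s b x≢w))))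

-- gameValue is driven by fuel and scores the position as it stands once the fuel runs out,
-- so a strategy argument must know that the fuel suffices to label every vertex.
record Fueled (m : ℕ) (s : State n) : Set where
  constructor fueled
  field unlabeled-≤ : length (unlabeled s) ≤ m

fueled-empty : Fueled n (emptyState {n})
fueled-empty {n} = fueled $ subst (λ xs → length xs ≤ n) (sym (unlabeled≡filter (emptyState {n}))) $
  ℕₚ.≤-trans (length-filter (unlabeled? (emptyState {n})) (allFin n)) (ℕₚ.≤-reflexive (length-tabulate (λ x → x)))

fueled-zero : Fueled 0 s → Complete s
fueled-zero {s = s} (fueled fuel) x ux with unlabeled s | ∈-unlabeled⁺ {s = s} ux
... | _ ∷ _ | _ with () ← fuel

fueled-update : Fueled (suc m) s → Unlabeled s w → Fueled m (update s w b)
fueled-update {m} {n} {s} {w} {b} (fueled fuel) uw = fueled $ ℕₚ.<⇒≤pred $ begin-strict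
  length (unlabeled s′)                       ≡⟨ cong length (unlabeled≡filter s′) ⟩
  length (filter (unlabeled? s′) (allFin n))  ≡⟨ cong length (sym (filter-filter-⊆ (unlabeled? s′) (unlabeled? s)
                                                                                  (update-unlabeled s w b) (allFin n))) ⟩
  length (filter (unlabeled? s′) before)      <⟨ filter-notAll (unlabeled? s′) before
                                                   (lose (∈-filter⁺ (unlabeled? s) (∈-allFin w) uw) labeled) ⟩
  length before                               ≡⟨ cong length (sym (unlabeled≡filter s)) ⟩
  length (unlabeled s)                        ≤⟨ fuel ⟩
  suc m                                       ∎
  where
  open ℕₚ.≤-Reasoning
  s′ : State n
  s′ = update s w b
  before : List (Fin n)
  before = filter (unlabeled? s) (allFin n)
  labeled : ¬ Unlabeled s′ w
  labeled uw′ with () ← trans (sym (update-same s w b)) uw′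

Guarantees : Player → ℤ → ℤ → Set
Guarantees Adm K z = z ℤ.≤ K
Guarantees Imp K z = K ℤ.≤ z

guarantees-≡ : ∀ p {K z} → z ≡ K → Guarantees p K z
guarantees-≡ Adm refl = ℤₚ.≤-refl
guarantees-≡ Imp refl = ℤₚ.≤-refl

optimum-own : ∀ p {K} z zs → Guarantees p K z ⊎ Any (Guarantees p K) zs → Guarantees p K (optimum p z zs)
optimum-own Adm = foldr-preservesᵒ λ x y → [ ℤₚ.≤-trans (ℤₚ.i⊓j≤i x y) , ℤₚ.≤-trans (ℤₚ.i⊓j≤j x y) ]
optimum-own Imp = foldr-preservesᵒ λ x y →
  [ (λ K≤x → ℤₚ.≤-trans K≤x (ℤₚ.i≤i⊔j x y)) , (λ K≤y → ℤₚ.≤-trans K≤y (ℤₚ.i≤j⊔i x y)) ]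

optimum-other : ∀ p {K z zs} → Guarantees p K z → All (Guarantees p K) zs → Guarantees p K (optimum (other p) z zs)
optimum-other Adm = foldr-preservesᵇ ℤₚ.⊔-lub
optimum-other Imp = foldr-preservesᵇ ℤₚ.⊓-glb

other-involutive : ∀ p → other (other p) ≡ p
other-involutive Adm = refl
other-involutive Imp = refl

labelOf-other : ∀ p → labelOf (other p) ≢ labelOf p
labelOf-other Adm ()
labelOf-other Imp ()

module _ {n : ℕ} (G : SimpleGraph n) where

  afterMove : ℕ → Player → State n → Fin n → ℤ
  afterMove m p s u = gameValue G m (other p) (update s u (labelOf p))

  movesValue : ℕ → Player → State n → List (Fin n) → ℤ
  movesValue m p s []       = discrepancy G (finalLabel s)
  movesValue m p s (v ∷ vs) = optimum p (afterMove m p s v) (map (afterMove m p s) vs)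

  gameValue-suc : ∀ m p (s : State n) → gameValue G (suc m) p s ≡ movesValue m p s (unlabeled s)
  gameValue-suc m p s with unlabeled s
  ... | []    = refl
  ... | _ ∷ _ = refl

  gameValue-complete : ∀ m p → Complete s → gameValue G m p s ≡ discrepancy G (finalLabel s)
  gameValue-complete zero p complete = refl
  gameValue-complete {s = s} (suc m) p complete =
    trans (gameValue-suc m p s) (cong (movesValue m p s) (unlabeled-complete complete))

  module _ {p : Player} {K : ℤ} {m : ℕ} {s : State n} where

    own-move : Unlabeled s w → Guarantees p K (afterMove m p s w) → Guarantees p K (gameValue G (suc m) p s)
    own-move {w} uw good = subst (Guarantees p K) (sym (gameValue-suc m p s)) (choose (∈-unlabeled⁺ uw))
      where
      choose : ∀ {xs} → w ∈ xs → Guarantees p K (movesValue m p s xs)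
      choose (here refl) = optimum-own p _ _ (inj₁ good)
      choose (there w∈) = optimum-own p _ _ (inj₂ (Any.map⁺ (lose {P = Guarantees p K ∘ afterMove m p s} w∈ good)))

    other-move : (Complete s → Guarantees p K (discrepancy G (finalLabel s))) →
                 (∀ u → Unlabeled s u → Guarantees p K (gameValue G m p (update s u (labelOf (other p))))) →
                 Guarantees p K (gameValue G (suc m) (other p) s)
    other-move done good = subst (Guarantees p K) (sym (gameValue-suc m (other p) s)) (answer (unlabeled s) refl)
      where
      answer : ∀ xs → unlabeled s ≡ xs → Guarantees p K (movesValue m (other p) s xs)
      answer [] eq = done λ x ux → case subst (x ∈_) eq (∈-unlabeled⁺ ux) of λ ()
      answer (v ∷ vs) eq = optimum-other p (good′ (here refl)) (All.map⁺ (All.tabulate (good′ ∘ there)))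
        where
        good′ : ∀ {u} → u ∈ v ∷ vs → Guarantees p K (afterMove m (other p) s u)
        good′ {u} u∈ = subst (λ q → Guarantees p K (gameValue G m q (update s u (labelOf (other p)))))
                         (sym (other-involutive p)) (good u (∈-unlabeled⁻ (subst (u ∈_) (sym eq) u∈)))

-- The pairing strategy

Splits : (Fin n → Fin n) → (Fin n → Bool) → Set
Splits τ ℓ = ∀ x → τ x ≢ x → ℓ (τ x) ≡ not (ℓ x)

finalLabel-just : s x ≡ just b → finalLabel s x ≡ b
finalLabel-just {s = s} {x = x} sx≡b rewrite sx≡b = refl

module Balance {n : ℕ} (τ : Fin n → Fin n) (τ-involutive : ∀ x → τ (τ x) ≡ x) where

  Balanced : State n → Set
  Balanced s = ∀ x → τ x ≢ x → s (τ x) ≡ Maybe.map not (s x)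

  τ-injective : τ x ≡ τ w → x ≡ w
  τ-injective {x} {w} τx≡τw = trans (sym (τ-involutive x)) (trans (cong τ τx≡τw) (τ-involutive w))

  balanced-≗ : s ≗ t → Balanced s → Balanced t
  balanced-≗ {s = s} {t} s≗t balanced x unfixed =
    trans (sym (s≗t (τ x))) (trans (balanced x unfixed) (cong (Maybe.map not) (s≗t x)))

  balanced-empty : Balanced (emptyState {n})
  balanced-empty x _ = refl

  complete-splits : Complete s → Balanced s → Splits τ (finalLabel s)
  complete-splits {s = s} complete balanced x unfixed with s x in sx
  ... | nothing = ⊥-elim (complete x sx)
  ... | just a = finalLabel-just {s = s} (trans (balanced x unfixed) (cong (Maybe.map not) sx))

  balanced-fixed : τ w ≡ w → Balanced s → Balanced (update s w b)
  balanced-fixed {w} {s} {b} fixed balanced x unfixed =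
    trans (update-other s b τx≢w)
      (trans (balanced x unfixed) (cong (Maybe.map not) (sym (update-other s b x≢w))))
    where
    x≢w : x ≢ w
    x≢w refl = unfixed fixed
    τx≢w : τ x ≢ w
    τx≢w τx≡w = x≢w (trans (sym (τ-involutive x)) (trans (cong τ τx≡w) fixed))

  balanced-pair : τ u ≢ u → a ≢ b → Balanced s → Balanced (update (update s u b) (τ u) a)
  balanced-pair {u} {a} {b} {s} unfixed a≢b balanced x unfixedₓ = by-cases (x ≟ᶠ u) (x ≟ᶠ τ u)
    where
    s₁ s₂ : State n
    s₁ = update s u b
    s₂ = update s₁ (τ u) a
    u≢τu : u ≢ τ u
    u≢τu u≡τu = unfixed (sym u≡τu)
    s₂u : s₂ u ≡ just b
    s₂u = trans (update-other s₁ a u≢τu) (update-same s u b)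
    by-cases : Dec (x ≡ u) → Dec (x ≡ τ u) → s₂ (τ x) ≡ Maybe.map not (s₂ x)
    by-cases (yes refl) _ =
      trans (update-same s₁ (τ u) a) (trans (cong just (Boolₚ.¬-not a≢b)) (cong (Maybe.map not) (sym s₂u)))
    by-cases (no _) (yes refl) = trans (cong s₂ (τ-involutive u))
      (trans s₂u (trans (cong just (Boolₚ.¬-not (a≢b ∘ sym))) (cong (Maybe.map not) (sym (update-same s₁ (τ u) a)))))
    by-cases (no x≢u) (no x≢τu) =
      trans (update-other s₁ a (x≢u ∘ τ-injective)) (trans (update-other s b τx≢u) (trans (balanced x unfixedₓ)
        (cong (Maybe.map not) (sym (trans (update-other s₁ a x≢τu) (update-other s b x≢u))))))
      where
      τx≢u : τ x ≢ u
      τx≢u τx≡u = x≢τu (trans (sym (τ-involutive x)) (cong τ τx≡u))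

  balanced-partner : τ u ≢ u → Balanced s → Unlabeled s u → Unlabeled (update s u b) (τ u)
  balanced-partner {u} {s} {b} unfixed balanced uu =
    trans (update-other s b unfixed) (trans (balanced u unfixed) (cong (Maybe.map not) uu))

module PairingStrategy {n : ℕ} (G : SimpleGraph n) (τ : Fin n → Fin n) (τ-involutive : ∀ x → τ (τ x) ≡ x)
  {K : ℤ} (splits⇒K : ∀ ℓ → Splits τ ℓ → discrepancy G ℓ ≡ K) (P : Player) where

  open Balance τ τ-involutive

  private
    Q : Player
    Q = other P
    lp lq : Bool
    lp = labelOf P
    lq = labelOf Q

  -- P has labeled `opened` but not its partner. The position is only determined pointwise, since
  -- answering an exchange reaches the same position through a different sequence of updates.
  record Opened (s : State n) : Set where
    field
      base           : State n
      opened         : Fin n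
      base-balanced  : Balanced base
      opened-unfixed : τ opened ≢ opened
      opened-fresh   : Unlabeled base opened
      fixed-labeled  : ∀ x → τ x ≡ x → ¬ Unlabeled base x
      state≗         : s ≗ update base opened lp

  module _ {s : State n} (o : Opened s) where
    open Opened o

    state-off-opened : x ≢ opened → s x ≡ base x
    state-off-opened x≢o = trans (state≗ _) (update-other base lp x≢o)

    unlabeled-≢-opened : Unlabeled s x → x ≢ opened
    unlabeled-≢-opened ux refl with () ← trans (sym (trans (state≗ opened) (update-same base opened lp))) ux

    partner-unlabeled : Unlabeled s (τ opened)
    partner-unlabeled = trans (state-off-opened opened-unfixed)
      (trans (base-balanced opened opened-unfixed) (cong (Maybe.map not) opened-fresh))

    closed-balanced : Balanced (update s (τ opened) lq)
    closed-balanced = balanced-≗ (λ x → sym (update-cong state≗ (τ opened) lq x))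
      (balanced-pair opened-unfixed (labelOf-other P) base-balanced)

    module _ {u : Fin n} (uu : Unlabeled s u) (u≢τo : u ≢ τ opened) (unfixed : τ u ≢ u) where

      private
        u≢o : u ≢ opened
        u≢o = unlabeled-≢-opened uu
        τu≢o : τ u ≢ opened
        τu≢o τu≡o = u≢τo (trans (sym (τ-involutive u)) (cong τ τu≡o))

      exchange-partner-unlabeled : Unlabeled (update s u lq) (τ u)
      exchange-partner-unlabeled = trans (update-other s lq unfixed) (trans (state-off-opened τu≢o)
        (trans (base-balanced u unfixed) (cong (Maybe.map not) (trans (sym (state-off-opened u≢o)) uu))))

      exchanged : Opened (update (update s u lq) (τ u) lp)
      exchanged = record
        { base           = base′
        ; opened         = opened
        ; base-balanced  = balanced-pair unfixed (labelOf-other P ∘ sym) base-balanced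
        ; opened-unfixed = opened-unfixed
        ; opened-fresh   = trans (update-other base₁ lp (τu≢o ∘ sym))
                             (trans (update-other base lq (u≢o ∘ sym)) opened-fresh)
        ; fixed-labeled  = λ x fixed ux → fixed-labeled x fixed
                             (update-unlabeled {x = x} base u lq (update-unlabeled {x = x} base₁ (τ u) lp ux))
        ; state≗         = λ x → trans (update-cong (update-cong state≗ u lq) (τ u) lp x)
                                  (trans (update-cong (update-comm base (u≢o ∘ sym)) (τ u) lp x)
                                  (update-comm base₁ (τu≢o ∘ sym) x))
        }
        where
        base₁ base′ : State n
        base₁ = update base u lq
        base′ = update base₁ (τ u) lp

  terminal : Complete s → Balanced s → Guarantees P K (discrepancy G (finalLabel s))
  terminal complete balanced = guarantees-≡ P (splits⇒K _ (complete-splits complete balanced))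

  mutual
    -- P labels free fixed vertices first: while a pair is open the opponent then either closes it
    -- or labels a vertex of a fresh pair, whose partner P labels at once.
    own-balanced : ∀ m → Fueled m s → Balanced s → Guarantees P K (gameValue G m P s)
    own-balanced zero fuel balanced = terminal (fueled-zero fuel) balanced
    own-balanced {s} (suc m) fuel balanced with any? (λ x → τ x ≟ᶠ x ×-dec unlabeled? s x)
    ... | yes (w , fixed , uw) =
      own-move G uw (other-balanced m (fueled-update fuel uw) (balanced-fixed fixed balanced))
    ... | no no-fixed with any? (unlabeled? s)
    ...   | yes (w , uw) = own-move G uw (other-opened m (fueled-update fuel uw) opening)
      where
      opening : Opened (update s w lp)
      opening = record
        { base = s ; opened = w ; base-balanced = balanced
        ; opened-unfixed = λ fixed → no-fixed (w , fixed , uw)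
        ; opened-fresh = uw
        ; fixed-labeled = λ x fixed ux → no-fixed (x , fixed , ux)
        ; state≗ = λ _ → refl }
    ...   | no none =
      subst (Guarantees P K) (sym (gameValue-complete G (suc m) P complete)) (terminal complete balanced)
      where
      complete : Complete s
      complete x ux = none (x , ux)

    other-balanced : ∀ m → Fueled m s → Balanced s → Guarantees P K (gameValue G m Q s)
    other-balanced zero fuel balanced = terminal (fueled-zero fuel) balanced
    other-balanced (suc m) fuel balanced = other-move G (λ complete → terminal complete balanced)
      (λ u uu → answer-balanced m (fueled-update fuel uu) balanced uu)

    answer-balanced : ∀ m → Fueled m (update s u lq) → Balanced s → Unlabeled s u →
                      Guarantees P K (gameValue G m P (update s u lq))
    answer-balanced {u = u} m fuel balanced uu with τ u ≟ᶠ u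
    ... | yes fixed = own-balanced m fuel (balanced-fixed fixed balanced)
    answer-balanced {u = u} zero fuel balanced uu | no unfixed =
      ⊥-elim (fueled-zero fuel (τ u) (balanced-partner unfixed balanced uu))
    answer-balanced {s} {u} (suc m) fuel balanced uu | no unfixed = own-move G partner
      (other-balanced m (fueled-update fuel partner) (balanced-pair unfixed (labelOf-other P ∘ sym) balanced))
      where
      partner : Unlabeled (update s u lq) (τ u)
      partner = balanced-partner unfixed balanced uu

    other-opened : ∀ m → Fueled m s → Opened s → Guarantees P K (gameValue G m Q s)
    other-opened zero fuel o = ⊥-elim (fueled-zero fuel _ (partner-unlabeled o))
    other-opened (suc m) fuel o = other-move G (λ complete → ⊥-elim (complete _ (partner-unlabeled o)))
      (λ u uu → answer-opened m (fueled-update fuel uu) o uu)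

    answer-opened : ∀ m → Fueled m (update s u lq) → Opened s → Unlabeled s u →
                    Guarantees P K (gameValue G m P (update s u lq))
    answer-opened {u = u} m fuel o uu with u ≟ᶠ τ (Opened.opened o) | τ u ≟ᶠ u
    ... | yes refl | _ = own-balanced m fuel (closed-balanced o)
    ... | no _ | yes fixed = ⊥-elim (Opened.fixed-labeled o u fixed
                               (trans (sym (state-off-opened o (unlabeled-≢-opened o uu))) uu))
    answer-opened {u = u} zero fuel o uu | no u≢τo | no unfixed =
      ⊥-elim (fueled-zero fuel (τ u) (exchange-partner-unlabeled o uu u≢τo unfixed))
    answer-opened {s} {u} (suc m) fuel o uu | no u≢τo | no unfixed =
      own-move G partner (other-opened m (fueled-update fuel partner) (exchanged o uu u≢τo unfixed))
      where
      partner : Unlabeled (update s u lq) (τ u)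
      partner = exchange-partner-unlabeled o uu u≢τo unfixed

  own-first : Guarantees P K (gameValue G n P emptyState)
  own-first = own-balanced n fueled-empty balanced-empty

  other-first : Guarantees P K (gameValue G n Q emptyState)
  other-first = other-balanced n fueled-empty balanced-empty

pairing-strategy-value : (G : SimpleGraph n) (τ : Fin n → Fin n) → (∀ x → τ (τ x) ≡ x) →
  {K : ℤ} → (∀ ℓ → Splits τ ℓ → discrepancy G ℓ ≡ K) → ∀ p → gameValue G n p emptyState ≡ K
pairing-strategy-value {n} G τ τ-involutive {K} splits⇒K = value
  where
  module A = PairingStrategy G τ τ-involutive splits⇒K Adm
  module I = PairingStrategy G τ τ-involutive splits⇒K Imp
  value : ∀ p → gameValue G n p emptyState ≡ K
  value Adm = ℤₚ.≤-antisym A.own-first I.other-first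
  value Imp = ℤₚ.≤-antisym A.other-first I.own-first

T-true : ∀ {b} → T b → b ≡ true
T-true {true} _ = refl

T-false : ∀ {b} → ¬ T b → b ≡ false
T-false {true} ¬t = ⊥-elim (¬t tt)
T-false {false} _ = refl

<ᵇ-true : i < j → (i <ᵇ j) ≡ true
<ᵇ-true = T-true ∘ ℕₚ.<⇒<ᵇ

<ᵇ-false : j ≤ i → (i <ᵇ j) ≡ false
<ᵇ-false {j} {i} j≤i = T-false (ℕₚ.≤⇒≯ j≤i ∘ ℕₚ.<ᵇ⇒< i j)

≡ᵇ-refl : ∀ i → (i ≡ᵇ i) ≡ true
≡ᵇ-refl i = T-true (ℕₚ.≡⇒≡ᵇ i i refl)

≡ᵇ-false : i ≢ j → (i ≡ᵇ j) ≡ false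
≡ᵇ-false {i} {j} i≢j = T-false (i≢j ∘ ℕₚ.≡ᵇ⇒≡ i j)

twice : ℕ → ℕ
twice zero    = zero
twice (suc i) = suc (suc (twice i))

twice≡*2 : ∀ i → twice i ≡ i * 2
twice≡*2 zero    = refl
twice≡*2 (suc i) = cong (λ t → suc (suc t)) (twice≡*2 i)

twice-mono-≤ : i ≤ j → twice i ≤ twice j
twice-mono-≤ z≤n       = z≤n
twice-mono-≤ (s≤s i≤j) = s≤s (s≤s (twice-mono-≤ i≤j))

parity : ∀ n → n ≡ twice (n / 2) ⊎ n ≡ suc (twice (n / 2))
parity n = by-remainder (n % 2) (m%n<n n 2) (m≡m%n+[m/n]*n n 2)
  where
  by-remainder : ∀ r → r < 2 → n ≡ r ℕ.+ n / 2 * 2 → n ≡ twice (n / 2) ⊎ n ≡ suc (twice (n / 2))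
  by-remainder 0 _ n≡ = inj₁ (trans n≡ (sym (twice≡*2 _)))
  by-remainder 1 _ n≡ = inj₂ (trans n≡ (cong suc (sym (twice≡*2 _))))
  by-remainder (suc (suc r)) (s≤s (s≤s ())) _

-- In the canonical layout of Defs, side s ∈ {0, 1} of the pair f_i is the vertex s + 2i.
vertex-/2 : ∀ {s} → s < 2 → (s ℕ.+ twice i) / 2 ≡ i
vertex-/2 {i} {s} s<2 = begin
  (s ℕ.+ twice i) / 2    ≡⟨ cong (λ t → (s ℕ.+ t) / 2) (twice≡*2 i) ⟩
  (s ℕ.+ i * 2) / 2    ≡⟨ +-distrib-/-∣ʳ s (divides i refl) ⟩
  s / 2 ℕ.+ i * 2 / 2  ≡⟨ cong₂ ℕ._+_ (m<n⇒m/n≡0 s<2) (m*n/n≡m i 2) ⟩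
  i                      ∎
  where open ≡-Reasoning

vertex-%2 : ∀ {s} → s < 2 → (s ℕ.+ twice i) % 2 ≡ s
vertex-%2 {i} {s} s<2 =
  trans (cong (λ t → (s ℕ.+ t) % 2) (twice≡*2 i)) (trans ([m+kn]%n≡m%n s i 2) (m<n⇒m%n≡m s<2))

vertex-< : ∀ {s} → s < 2 → i < m → s ℕ.+ twice i < twice m
vertex-< {i} s<2 i<m = ℕₚ.≤-trans (s≤s (ℕₚ.+-monoˡ-≤ (twice i) (ℕₚ.≤-pred s<2))) (twice-mono-≤ i<m)

indicator : ℕ → ℕ → ℤ
indicator k i = if i <ᵇ k then + 1 else + 0

-- Opaque, so that unification sees ∑< N f itself rather than a Fin-indexed sum of f ∘ toℕ.
opaque
  ∑< : ℕ → (ℕ → ℤ) → ℤ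
  ∑< N f = sum {N} (f ∘ toℕ)

  ∑<-cong : (∀ i → i < N → f i ≡ g i) → ∑< N f ≡ ∑< N g
  ∑<-cong f≡g = sum-cong-≗ λ x → f≡g (toℕ x) (Finₚ.toℕ<n x)

  ∑<-zero : (∀ i → i < N → f i ≡ + 0) → ∑< N f ≡ + 0
  ∑<-zero {N} f≡0 = trans (∑<-cong f≡0) (sum-replicate-zero N)

  ∑<-last : ∀ N f → ∑< (suc N) f ≡ ∑< N f + f N
  ∑<-last N f = trans (sum-init-last {N} (f ∘ toℕ))
    (cong₂ _+_ (sum-cong-≗ {N} (cong f ∘ Finₚ.toℕ-inject₁)) (cong f (Finₚ.toℕ-fromℕ N)))

  ∑<-pairs : ∀ m f → ∑< (twice m) f ≡ ∑< m (λ i → f (twice i) + f (suc (twice i)))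
  ∑<-pairs zero    f = refl
  ∑<-pairs (suc m) f = trans (sym (ℤₚ.+-assoc (f 0) (f 1) _)) (cong (_+_ (f 0 + f 1)) (∑<-pairs m λ i → f (suc (suc i))))

  ∑<-delta : i < N → (∀ j → j < N → j ≢ i → f j ≡ + 0) → ∑< N f ≡ f i
  ∑<-delta {zero}  {suc N} {f} _ others =
    trans (cong (_+_ (f 0)) (∑<-zero λ j j<N → others (suc j) (s≤s j<N) λ ())) (ℤₚ.+-identityʳ (f 0))
  ∑<-delta {suc i} {suc N} {f} (s≤s i<N) others =
    trans (cong (_+ ∑< N (λ j → f (suc j))) (others 0 z<s λ ()))
      (trans (ℤₚ.+-identityˡ _) (∑<-delta i<N λ j j<N j≢i → others (suc j) (s≤s j<N) (j≢i ∘ ℕₚ.suc-injective)))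

  ∑<-indicator : k ≤ N → ∑< N (indicator k) ≡ + k
  ∑<-indicator {zero}  {N}     _         = ∑<-zero {N} λ _ _ → refl
  ∑<-indicator {suc k} {suc N} (s≤s k≤N) = cong (_+_ (+ 1)) (∑<-indicator k≤N)

  ∑<∑<-toℕ : ∀ N (F : ℕ → ℕ → ℤ) → ∑< N (λ x → ∑< N (F x)) ≡ ∑[ x < N ] ∑[ y < N ] F (toℕ x) (toℕ y)
  ∑<∑<-toℕ N F = refl

  ∑<-distrib : ∀ N f g → ∑< N (λ i → f i + g i) ≡ ∑< N f + ∑< N g
  ∑<-distrib N f g = ∑-distrib-+ {N} (f ∘ toℕ) (g ∘ toℕ)

∑<∑<-suc : ∀ N (F : ℕ → ℕ → ℤ) → ∑< (suc N) (λ x → ∑< (suc N) (F x)) ≡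
  (∑< N (λ x → ∑< N (F x)) + ∑< N (λ x → F x N)) + (∑< N (F N) + F N N)
∑<∑<-suc N F = trans (∑<-cong {suc N} (λ x _ → ∑<-last N (F x)))
  (trans (∑<-last N (λ x → ∑< N (F x) + F x N))
    (cong (_+ (∑< N (F N) + F N N)) (∑<-distrib N (λ x → ∑< N (F x)) (λ x → F x N))))

-- Discrepancy of the canonical graphs

edgeSign : Bool → Bool → ℤ
edgeSign e z = if e then (if z then + 1 else - (+ 1)) else + 0

edgeSign-not : ∀ e z → edgeSign e z + edgeSign e (not z) ≡ + 0
edgeSign-not false _     = refl
edgeSign-not true  false = refl
edgeSign-not true  true  = refl

xor-not-self : ∀ a → a xor not a ≡ true
xor-not-self a = trans (sym (Boolₚ.not-distribʳ-xor a a)) (cong not (Boolₚ.xor-same a))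

-- The adjacencies e_st between side s of one pair and side t of another: either each vertex of
-- the first pair sees both or neither vertex of the second, or vice versa.
StarShaped : Bool → Bool → Bool → Bool → Set
StarShaped e₀₀ e₀₁ e₁₀ e₁₁ = (e₀₀ ≡ e₀₁ × e₁₀ ≡ e₁₁) ⊎ (e₀₀ ≡ e₁₀ × e₀₁ ≡ e₁₁)

connEdge-starShaped : ∀ cn → StarShaped (connEdge cn 0 0) (connEdge cn 0 1) (connEdge cn 1 0) (connEdge cn 1 1)
connEdge-starShaped noEdges    = inj₁ (refl , refl)
connEdge-starShaped k22        = inj₁ (refl , refl)
connEdge-starShaped (p3low _)  = inj₁ (refl , refl)
connEdge-starShaped (p3high _) = inj₂ (refl , refl)

0<2 : 0 < 2
0<2 = s≤s z≤n

1<2 : 1 < 2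
1<2 = s≤s (s≤s z≤n)

module Canonical (n k : ℕ) (c : ℕ → ℕ → Conn) (cv : ℕ → Bool) where

  half : ℕ
  half = n / 2

  adjacent : ℕ → ℕ → Bool
  adjacent = canonAdj n k c cv

  private
    inPairs : ∀ {x} → x < twice half → (x <ᵇ 2 * half) ≡ true
    inPairs {x} x< = subst (λ N → (x <ᵇ N) ≡ true) (trans (twice≡*2 half) (ℕₚ.*-comm half 2)) (<ᵇ-true x<)

    extra-notInPairs : (twice half <ᵇ 2 * half) ≡ false
    extra-notInPairs = <ᵇ-false (ℕₚ.≤-reflexive (trans (sym (ℕₚ.*-comm half 2)) (sym (twice≡*2 half))))

  canonAdj-self : ∀ x → adjacent x x ≡ false
  canonAdj-self x rewrite ≡ᵇ-refl x = refl

  canonAdj-pairs : ∀ {s t} → i < half → j < half → s < 2 → t < 2 → s ℕ.+ twice i ≢ t ℕ.+ twice j →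
    adjacent (s ℕ.+ twice i) (t ℕ.+ twice j) ≡
      (if i ≡ᵇ j then i <ᵇ k else if i <ᵇ j then connEdge (c i j) s t else connEdge (c j i) t s)
  canonAdj-pairs {i} {j} i< j< s< t< distinct
    rewrite ≡ᵇ-false distinct | inPairs (vertex-< s< i<) | inPairs (vertex-< t< j<)
          | vertex-/2 {i} s< | vertex-/2 {j} t< | vertex-%2 {i} s< | vertex-%2 {j} t< = refl

  canonAdj-between : ∀ {s t} → i < half → j < half → i ≢ j → s < 2 → t < 2 →
    adjacent (s ℕ.+ twice i) (t ℕ.+ twice j) ≡ (if i <ᵇ j then connEdge (c i j) s t else connEdge (c j i) t s)
  canonAdj-between {i} {j} {s} {t} i< j< i≢j s< t< =
    trans (canonAdj-pairs i< j< s< t< different)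
      (cong (λ b → if b then i <ᵇ k else (if i <ᵇ j then connEdge (c i j) s t else connEdge (c j i) t s)) (≡ᵇ-false i≢j))
    where
    different : s ℕ.+ twice i ≢ t ℕ.+ twice j
    different eq = i≢j (trans (sym (vertex-/2 s<)) (trans (cong (_/ 2) eq) (vertex-/2 t<)))

  canonAdj-within : ∀ {s t} → i < half → s < 2 → t < 2 → s ≢ t → adjacent (s ℕ.+ twice i) (t ℕ.+ twice i) ≡ (i <ᵇ k)
  canonAdj-within {i} {s} {t} i< s< t< s≢t =
    trans (canonAdj-pairs i< i< s< t< different)
      (cong (λ b → if b then i <ᵇ k else (if i <ᵇ i then connEdge (c i i) s t else connEdge (c i i) t s)) (≡ᵇ-refl i))
    where
    different : s ℕ.+ twice i ≢ t ℕ.+ twice i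
    different eq = s≢t (trans (sym (vertex-%2 s<)) (trans (cong (_% 2) eq) (vertex-%2 t<)))

  canonAdj-extraʳ : ∀ {s} → i < half → s < 2 → adjacent (s ℕ.+ twice i) (twice half) ≡ cv i
  canonAdj-extraʳ {i} i< s< rewrite ≡ᵇ-false (ℕₚ.<⇒≢ (vertex-< s< i<)) | inPairs (vertex-< s< i<)
    | extra-notInPairs | vertex-/2 {i} s< = refl

  canonAdj-extraˡ : ∀ {t} → j < half → t < 2 → adjacent (twice half) (t ℕ.+ twice j) ≡ cv j
  canonAdj-extraˡ {j} j< t< rewrite ≡ᵇ-false (ℕₚ.<⇒≢ (vertex-< t< j<) ∘ sym) | inPairs (vertex-< t< j<)
    | extra-notInPairs | vertex-/2 {j} t< = refl

  module Labelled (L : ℕ → Bool) (L-split : ∀ i → i < half → L (suc (twice i)) ≡ not (L (twice i))) where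

    weight : ℕ → ℕ → ℤ
    weight x y = edgeSign (adjacent x y) (L x xor L y)

    star-right : ∀ {x} → j < half → adjacent x (twice j) ≡ adjacent x (suc (twice j)) →
                 weight x (twice j) + weight x (suc (twice j)) ≡ + 0
    star-right {j} {x} j< same = trans (cong (_+_ (weight x (twice j))) (cong₂ edgeSign (sym same)
        (trans (cong (L x xor_) (L-split j j<)) (sym (Boolₚ.not-distribʳ-xor (L x) _)))))
      (edgeSign-not (adjacent x (twice j)) (L x xor L (twice j)))

    star-left : ∀ {y} → i < half → adjacent (twice i) y ≡ adjacent (suc (twice i)) y →
                weight (twice i) y + weight (suc (twice i)) y ≡ + 0
    star-left {i} {y} i< same = trans (cong (_+_ (weight (twice i) y)) (cong₂ edgeSign (sym same)
        (trans (cong (_xor L y) (L-split i i<)) (sym (Boolₚ.not-distribˡ-xor (L (twice i)) (L y))))))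
      (edgeSign-not (adjacent (twice i) y) (L (twice i) xor L y))

    block : ℕ → ℕ → ℤ
    block i j = (weight (twice i) (twice j) + weight (twice i) (suc (twice j)))
              + (weight (suc (twice i)) (twice j) + weight (suc (twice i)) (suc (twice j)))

    block-starShaped : i < half → j < half →
      StarShaped (adjacent (twice i) (twice j)) (adjacent (twice i) (suc (twice j)))
                 (adjacent (suc (twice i)) (twice j)) (adjacent (suc (twice i)) (suc (twice j))) →
      block i j ≡ + 0
    block-starShaped {i} {j} i< j< (inj₁ (row₀ , row₁)) =
      cong₂ _+_ (star-right {x = twice i} j< row₀) (star-right {x = suc (twice i)} j< row₁)
    block-starShaped {i} {j} i< j< (inj₂ (col₀ , col₁)) =
      trans (interchange (weight (twice i) (twice j)) (weight (twice i) (suc (twice j)))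
                         (weight (suc (twice i)) (twice j)) (weight (suc (twice i)) (suc (twice j))))
        (cong₂ _+_ (star-left {y = twice j} i< col₀) (star-left {y = suc (twice j)} i< col₁))

    block-between : i < half → j < half → i ≢ j → block i j ≡ + 0
    block-between {i} {j} i< j< i≢j = block-starShaped i< j< shape
      where
      shape : StarShaped (adjacent (twice i) (twice j)) (adjacent (twice i) (suc (twice j)))
                         (adjacent (suc (twice i)) (twice j)) (adjacent (suc (twice i)) (suc (twice j)))
      shape rewrite canonAdj-between {s = 0} {t = 0} i< j< i≢j 0<2 0<2 | canonAdj-between {s = 0} {t = 1} i< j< i≢j 0<2 1<2
                  | canonAdj-between {s = 1} {t = 0} i< j< i≢j 1<2 0<2 | canonAdj-between {s = 1} {t = 1} i< j< i≢j 1<2 1<2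
                  with i <ᵇ j
      ... | true  = connEdge-starShaped (c i j)
      ... | false = swap (connEdge-starShaped (c j i))

    block-within : i < half → block i i ≡ indicator k i + indicator k i
    block-within {i} i< = begin
      block i i                                   ≡⟨ cong₂ _+_ (cong₂ _+_ (loop (twice i)) (across-up))
                                                               (cong₂ _+_ across-down (loop (suc (twice i)))) ⟩
      (+ 0 + indicator k i) + (indicator k i + + 0) ≡⟨ cong₂ _+_ (ℤₚ.+-identityˡ (indicator k i)) (ℤₚ.+-identityʳ (indicator k i)) ⟩
      indicator k i + indicator k i               ∎
      where
      open ≡-Reasoning
      l : Bool
      l = L (twice i)
      loop : ∀ x → weight x x ≡ + 0
      loop x = cong (λ e → edgeSign e (L x xor L x)) (canonAdj-self x)
      across-up : weight (twice i) (suc (twice i)) ≡ edgeSign (i <ᵇ k) true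
      across-up = cong₂ edgeSign (canonAdj-within i< 0<2 1<2 λ ())
        (trans (cong (l xor_) (L-split i i<)) (xor-not-self l))
      across-down : weight (suc (twice i)) (twice i) ≡ edgeSign (i <ᵇ k) true
      across-down = cong₂ edgeSign (canonAdj-within i< 1<2 0<2 λ ())
        (trans (cong (_xor l) (L-split i i<)) (trans (sym (Boolₚ.not-distribˡ-xor l l)) (cong not (Boolₚ.xor-same l))))

    pairs-total : k ≤ half → ∑< (twice half) (λ x → ∑< (twice half) (weight x)) ≡ + k + + k
    pairs-total k≤ = begin
      ∑< (twice half) (λ x → ∑< (twice half) (weight x))
        ≡⟨ ∑<-pairs half (λ x → ∑< (twice half) (weight x)) ⟩
      ∑< half (λ i → ∑< (twice half) (weight (twice i)) + ∑< (twice half) (weight (suc (twice i))))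
        ≡⟨ ∑<-cong (λ i _ → rows i) ⟩
      ∑< half (λ i → ∑< half (block i))
        ≡⟨ ∑<-cong (λ i i< → trans (∑<-delta i< λ j j< j≢i → block-between i< j< (j≢i ∘ sym)) (block-within i<)) ⟩
      ∑< half (λ i → indicator k i + indicator k i)
        ≡⟨ ∑<-distrib half (indicator k) (indicator k) ⟩
      ∑< half (indicator k) + ∑< half (indicator k)
        ≡⟨ cong₂ _+_ (∑<-indicator k≤) (∑<-indicator k≤) ⟩
      + k + + k ∎
      where
      open ≡-Reasoning
      rows : ∀ i → ∑< (twice half) (weight (twice i)) + ∑< (twice half) (weight (suc (twice i))) ≡ ∑< half (block i)
      rows i = trans (cong₂ _+_ (∑<-pairs half _) (∑<-pairs half _)) (sym (∑<-distrib half _ _))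

    extra-column : ∑< (twice half) (λ x → weight x (twice half)) ≡ + 0
    extra-column = trans (∑<-pairs half _)
      (∑<-zero λ i i< → star-left {y = twice half} i< (trans (canonAdj-extraʳ i< 0<2) (sym (canonAdj-extraʳ i< 1<2))))

    extra-row : ∑< (twice half) (weight (twice half)) ≡ + 0
    extra-row = trans (∑<-pairs half _)
      (∑<-zero λ j j< → star-right {x = twice half} j< (trans (canonAdj-extraˡ j< 0<2) (sym (canonAdj-extraˡ j< 1<2))))

    extra-loop : weight (twice half) (twice half) ≡ + 0
    extra-loop = cong (λ e → edgeSign e (L (twice half) xor L (twice half))) (canonAdj-self (twice half))

    pairs-and-extra-total : k ≤ half →
      ∑< (suc (twice half)) (λ x → ∑< (suc (twice half)) (weight x)) ≡ + k + + k
    pairs-and-extra-total k≤ = begin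
      ∑< (suc (twice half)) (λ x → ∑< (suc (twice half)) (weight x))  ≡⟨ ∑<∑<-suc (twice half) weight ⟩
      (∑< (twice half) (λ x → ∑< (twice half) (weight x)) + ∑< (twice half) (λ x → weight x (twice half)))
        + (∑< (twice half) (weight (twice half)) + weight (twice half) (twice half))
        ≡⟨ cong₂ _+_ (cong₂ _+_ (pairs-total k≤) extra-column) (cong₂ _+_ extra-row extra-loop) ⟩
      ((+ k + + k) + + 0) + + 0                                       ≡⟨ trans (ℤₚ.+-identityʳ _) (ℤₚ.+-identityʳ _) ⟩
      + k + + k                                                       ∎
      where open ≡-Reasoning

    total : k ≤ half → ∑< n (λ x → ∑< n (weight x)) ≡ + k + + k
    total k≤ with parity n
    ... | inj₁ n≡ = subst (λ N → ∑< N (λ x → ∑< N (weight x)) ≡ + k + + k) (sym n≡) (pairs-total k≤)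
    ... | inj₂ n≡ = subst (λ N → ∑< N (λ x → ∑< N (weight x)) ≡ + k + + k) (sym n≡) (pairs-and-extra-total k≤)

-- Transfer to a graph of M_{n,k}

∑∑ : (Fin n → Fin n → ℤ) → ℤ
∑∑ {n} f = ∑[ x < n ] ∑[ y < n ] f x y

∑∑-cong : {f g : Fin n → Fin n → ℤ} → (∀ x y → f x y ≡ g x y) → ∑∑ f ≡ ∑∑ g
∑∑-cong f≡g = sum-cong-≗ λ x → sum-cong-≗ (f≡g x)

∑∑-distrib : (f g : Fin n → Fin n → ℤ) → ∑∑ (λ x y → f x y + g x y) ≡ ∑∑ f + ∑∑ g
∑∑-distrib {n} f g = trans (sum-cong-≗ λ x → ∑-distrib-+ (f x) (g x)) (∑-distrib-+ (λ x → ∑[ y < n ] f x y) _)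

∑∑-permute : (f : Fin n → Fin n → ℤ) (π : Permutation′ n) → ∑∑ f ≡ ∑∑ (λ x y → f (π ⟨$⟩ʳ x) (π ⟨$⟩ʳ y))
∑∑-permute f π = trans (sum-cong-≗ λ x → sum-permute (f x) π) (sum-permute (λ x → ∑[ y < _ ] f x (π ⟨$⟩ʳ y)) π)

foldr-tabulate : ∀ {m} (h : Fin m → Fin n) (f : Fin n → ℤ) z →
  foldr (λ x acc → f x + acc) z (tabulate h) ≡ ∑[ i < m ] f (h i) + z
foldr-tabulate {m = zero}  h f z = sym (ℤₚ.+-identityˡ z)
foldr-tabulate {m = suc m} h f z =
  trans (cong (_+_ (f (h zero))) (foldr-tabulate (h ∘ suc) f z)) (sym (ℤₚ.+-assoc (f (h zero)) _ z))

sumPairs≡∑∑ : (f : Fin n → Fin n → ℤ) → sumPairs f ≡ ∑∑ f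
sumPairs≡∑∑ {n} f = begin
  sumPairs f                                                 ≡⟨ foldr-cong (λ x → foldr-tabulate (λ y → y) (f x))
                                                                           refl (allFin n) ⟩
  foldr (λ x acc → ∑[ y < n ] f x y + acc) (+ 0) (allFin n) ≡⟨ foldr-tabulate (λ x → x) (λ x → ∑[ y < n ] f x y) (+ 0) ⟩
  ∑∑ f + + 0                                                 ≡⟨ ℤₚ.+-identityʳ (∑∑ f) ⟩
  ∑∑ f                                                       ∎
  where open ≡-Reasoning

discrepancy-double : (G : SimpleGraph n) (ℓ : Fin n → Bool) →
  discrepancy G ℓ + discrepancy G ℓ ≡ ∑∑ (λ x y → edgeSign (adj G x y) (ℓ x xor ℓ y))
discrepancy-double {n} G ℓ = begin
  discrepancy G ℓ + discrepancy G ℓ  ≡⟨ cong₂ _+_ (sumPairs≡∑∑ F) (trans (sumPairs≡∑∑ F) (∑-comm F)) ⟩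
  ∑∑ F + ∑∑ (λ x y → F y x)          ≡⟨ sym (∑∑-distrib F (λ x y → F y x)) ⟩
  ∑∑ (λ x y → F x y + F y x)         ≡⟨ ∑∑-cong symmetrised ⟩
  ∑∑ (λ x y → edgeSign (adj G x y) (ℓ x xor ℓ y)) ∎
  where
  open ≡-Reasoning
  F : Fin n → Fin n → ℤ
  F x y = if (toℕ x <ᵇ toℕ y) ∧ adj G x y then (if ℓ x xor ℓ y then + 1 else - (+ 1)) else + 0
  symmetrised : ∀ x y → F x y + F y x ≡ edgeSign (adj G x y) (ℓ x xor ℓ y)
  symmetrised x y with ℕₚ.<-cmp (toℕ x) (toℕ y)
  ... | tri< x<y _ _ rewrite <ᵇ-true x<y | <ᵇ-false (ℕₚ.<⇒≤ x<y) = ℤₚ.+-identityʳ _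
  ... | tri> _ _ y<x rewrite <ᵇ-false (ℕₚ.<⇒≤ y<x) | <ᵇ-true y<x | adj-sym G y x | Boolₚ.xor-comm (ℓ y) (ℓ x) =
    ℤₚ.+-identityˡ _
  ... | tri≈ _ x≡y _ with Finₚ.toℕ-injective x≡y
  ... | refl rewrite <ᵇ-false (ℕₚ.≤-refl {toℕ x}) | irrefl G x = refl

double-injective : ∀ {a b : ℤ} → a + a ≡ b + b → a ≡ b
double-injective {a} {b} eq with ℤₚ.<-cmp a b
... | tri< a<b _ _ = ⊥-elim (ℤₚ.<-irrefl eq (ℤₚ.+-mono-< a<b a<b))
... | tri≈ _ a≡b _ = a≡b
... | tri> _ _ b<a = ⊥-elim (ℤₚ.<-irrefl (sym eq) (ℤₚ.+-mono-< b<a b<a))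

-- Junk value false beyond the last vertex.
labelAt : (Fin n → Bool) → ℕ → Bool
labelAt {n} ℓ z with z ℕ.<? n
... | yes z<n = ℓ (fromℕ< z<n)
... | no _    = false

labelAt-toℕ : (ℓ : Fin n → Bool) (x : Fin n) → labelAt ℓ (toℕ x) ≡ ℓ x
labelAt-toℕ {n} ℓ x with toℕ x ℕ.<? n
... | yes x<n = cong ℓ (Finₚ.fromℕ<-toℕ x x<n)
... | no x≮n  = ⊥-elim (x≮n (Finₚ.toℕ<n x))

-- Swaps the two vertices 2i and 2i+1 of each pair f_i, fixing the extra vertex when n is odd.
pairSwap : Fin n → Fin n
pairSwap {suc zero}    zero          = zero
pairSwap {suc (suc n)} zero          = suc zero
pairSwap {suc (suc n)} (suc zero)    = zero
pairSwap {suc (suc n)} (suc (suc x)) = suc (suc (pairSwap x))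

pairSwap-involutive : ∀ (x : Fin n) → pairSwap (pairSwap x) ≡ x
pairSwap-involutive {suc zero}    zero          = refl
pairSwap-involutive {suc (suc n)} zero          = refl
pairSwap-involutive {suc (suc n)} (suc zero)    = refl
pairSwap-involutive {suc (suc n)} (suc (suc x)) = cong (λ y → suc (suc y)) (pairSwap-involutive x)

toℕ-pairSwap : ∀ (x : Fin n) i → toℕ x ≡ twice i → suc (twice i) < n → toℕ (pairSwap x) ≡ suc (twice i)
toℕ-pairSwap {suc zero}    zero          zero    _  (s≤s ())
toℕ-pairSwap {suc (suc n)} zero          zero    _  _               = refl
toℕ-pairSwap {suc (suc n)} (suc (suc x)) (suc i) eq (s≤s (s≤s lt)) =
  cong (λ y → suc (suc y)) (toℕ-pairSwap x i (ℕₚ.suc-injective (ℕₚ.suc-injective eq)) lt)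
toℕ-pairSwap {suc (suc n)} (suc zero)    zero    ()
toℕ-pairSwap {suc (suc n)} (suc zero)    (suc i) ()

twice-half≤ : ∀ n → twice (n / 2) ≤ n
twice-half≤ n with parity n
... | inj₁ n≡ = ℕₚ.≤-reflexive (sym n≡)
... | inj₂ n≡ = ℕₚ.≤-trans (ℕₚ.n≤1+n _) (ℕₚ.≤-reflexive (sym n≡))

pairSwap-splits : {ℓ : Fin n → Bool} → Splits pairSwap ℓ → ∀ i → i < n / 2 →
  labelAt ℓ (suc (twice i)) ≡ not (labelAt ℓ (twice i))
pairSwap-splits {n} {ℓ} split i i< = begin
  labelAt ℓ (suc (twice i))        ≡⟨ cong (labelAt ℓ) (sym toℕ-swapped) ⟩
  labelAt ℓ (toℕ (pairSwap lo))     ≡⟨ labelAt-toℕ ℓ (pairSwap lo) ⟩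
  ℓ (pairSwap lo)                   ≡⟨ split lo moved ⟩
  not (ℓ lo)                        ≡⟨ cong not (sym (labelAt-toℕ ℓ lo)) ⟩
  not (labelAt ℓ (toℕ lo))          ≡⟨ cong (not ∘ labelAt ℓ) (Finₚ.toℕ-fromℕ< 2i<n) ⟩
  not (labelAt ℓ (twice i))        ∎
  where
  open ≡-Reasoning
  2i+1<n : suc (twice i) < n
  2i+1<n = ℕₚ.≤-trans (vertex-< 1<2 i<) (twice-half≤ n)
  2i<n : twice i < n
  2i<n = ℕₚ.<-trans (ℕₚ.n<1+n (twice i)) 2i+1<n
  lo : Fin n
  lo = fromℕ< 2i<n
  toℕ-swapped : toℕ (pairSwap lo) ≡ suc (twice i)
  toℕ-swapped = toℕ-pairSwap lo i (Finₚ.toℕ-fromℕ< 2i<n) 2i+1<n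
  moved : pairSwap lo ≢ lo
  moved eq = ℕₚ.1+n≢n (trans (sym toℕ-swapped) (trans (cong toℕ eq) (Finₚ.toℕ-fromℕ< 2i<n)))

conjugate : Permutation′ n → (Fin n → Fin n) → Fin n → Fin n
conjugate π σ u = π ⟨$⟩ʳ σ (π ⟨$⟩ˡ u)

conjugate-involutive : (π : Permutation′ n) (σ : Fin n → Fin n) → (∀ x → σ (σ x) ≡ x) →
  ∀ u → conjugate π σ (conjugate π σ u) ≡ u
conjugate-involutive π σ σ-involutive u =
  trans (cong (λ y → π ⟨$⟩ʳ σ y) (inverseˡ π)) (trans (cong (π ⟨$⟩ʳ_) (σ-involutive _)) (inverseʳ π))

conjugate-splits : (π : Permutation′ n) {σ : Fin n → Fin n} {ℓ : Fin n → Bool} →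
  Splits (conjugate π σ) ℓ → Splits σ (ℓ ∘ (π ⟨$⟩ʳ_))
conjugate-splits π {σ} {ℓ} split x moved =
  trans (cong ℓ (sym conj-πx)) (split (π ⟨$⟩ʳ x) (moved ∘ π-injective ∘ trans (sym conj-πx)))
  where
  conj-πx : conjugate π σ (π ⟨$⟩ʳ x) ≡ π ⟨$⟩ʳ σ x
  conj-πx = cong (λ y → π ⟨$⟩ʳ σ y) (inverseˡ π)
  π-injective : ∀ {y z} → π ⟨$⟩ʳ y ≡ π ⟨$⟩ʳ z → y ≡ z
  π-injective {y} {z} eq = trans (sym (inverseˡ π)) (trans (cong (π ⟨$⟩ˡ_) eq) (inverseˡ π))

half-≤ : 2 * k ≤ n → k ≤ n / 2
half-≤ {k} 2k≤n = subst (_≤ _) (trans (cong (_/ 2) (ℕₚ.*-comm 2 k)) (m*n/n≡m k 2)) (/-monoˡ-≤ 2 2k≤n)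

canonical-discrepancy : ∀ n k c cv → 2 * k ≤ n → (G : SimpleGraph n) (π : Permutation′ n) →
  (∀ x y → adj G (π ⟨$⟩ʳ x) (π ⟨$⟩ʳ y) ≡ canonAdj n k c cv (toℕ x) (toℕ y)) →
  ∀ ℓ → Splits (conjugate π pairSwap) ℓ → discrepancy G ℓ ≡ + k
canonical-discrepancy n k c cv 2k≤n G π iso ℓ split = double-injective (begin
  discrepancy G ℓ + discrepancy G ℓ                      ≡⟨ discrepancy-double G ℓ ⟩
  ∑∑ (λ x y → edgeSign (adj G x y) (ℓ x xor ℓ y))        ≡⟨ ∑∑-permute _ π ⟩
  ∑∑ (λ x y → edgeSign (adj G (π ⟨$⟩ʳ x) (π ⟨$⟩ʳ y)) (ℓπ x xor ℓπ y)) ≡⟨ ∑∑-cong canonical ⟩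
  ∑∑ {n} (λ x y → weight (toℕ x) (toℕ y))                ≡⟨ sym (∑<∑<-toℕ n weight) ⟩
  ∑< n (λ x → ∑< n (weight x))                           ≡⟨ total (half-≤ 2k≤n) ⟩
  + k + + k                                              ∎)
  where
  open ≡-Reasoning
  ℓπ : Fin n → Bool
  ℓπ = ℓ ∘ (π ⟨$⟩ʳ_)
  open Canonical n k c cv
  open Labelled (labelAt ℓπ) (pairSwap-splits (conjugate-splits π split))
  canonical : ∀ x y → edgeSign (adj G (π ⟨$⟩ʳ x) (π ⟨$⟩ʳ y)) (ℓπ x xor ℓπ y) ≡ weight (toℕ x) (toℕ y)
  canonical x y = cong₂ edgeSign (iso x y) (sym (cong₂ _xor_ (labelAt-toℕ ℓπ x) (labelAt-toℕ ℓπ y)))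

theorem2p7 : (n k : ℕ) → 2 * k ≤ n → (G : SimpleGraph n) → InM n k G →
    (bgA G ≡ + k) × (bgI G ≡ + k)
theorem2p7 n k 2k≤n G (c , cv , π , iso) = value Adm , value Imp
  where
  value : ∀ p → gameValue G n p emptyState ≡ + k
  value = pairing-strategy-value G (conjugate π pairSwap) (conjugate-involutive π pairSwap pairSwap-involutive)
            (canonical-discrepancy n k c cv 2k≤n G π iso)
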